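{- Let $G$ be a connected cubic graph with $V(G)=\{u_1,\dots,u_n\}$, and for an integer $d\ge 3$ let $H_d$ be the graph obtained as follows: take $d-2$ disjoint copies $G_1,\dots,G_{d-2}$ of $G$, let $z_{(i,j)}$ denote the copy of $u_i$ in $G_j$, and for each $i\in\{1,\dots,n\}$ add all edges between the vertices $z_{(i,1)},\dots,z_{(i,d-2)}$ so that they form a clique (so $H_3\cong G$). Then for every $d\ge 3$, $b(G)\le b(H_d)\le b(G)+1$.
   Context: All graphs are finite, simple and undirected. A sequence $(b_1,\dots,b_k)$ of vertices of a graph $G$ is a burning sequence if each $b_i$ is not yet burned at the end of step $i-1$ (where at each step fire spreads from every burned vertex to all its neighbours and then the next source is added) and for every $v\in V(G)$ there is an $i$ with $d_G(v,b_i)\le k-i$. The burning number $b(G)$ is the minimum length of a burning sequence of $G$. -}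

module Defs where

open import Data.Nat using (ℕ; zero; suc; _≤_; _<_; _∸_)
open import Data.Fin using (Fin; toℕ)
open import Data.Bool using (Bool; T)
open import Data.List using (length; filterᵇ)
open import Data.List.Base using (allFin)
open import Data.Product using (Σ; ∃; _×_; _,_)
open import Data.Sum using (_⊎_)
open import Relation.Binary.PropositionalEquality using (_≡_; _≢_)
open import Relation.Nullary using (¬_)

record SimpleGraph (n : ℕ) : Set where
  field
    adj     : Fin n → Fin n → Bool
    adj-sym : ∀ u v → adj u v ≡ adj v u
    adj-irr : ∀ v → adj v v ≡ Bool.false
open SimpleGraph public

record Graph : Set₁ where
  field
    V : Set
    E : V → V → Set
open Graph public

toGraph : ∀ {n} → SimpleGraph n → Graph
toGraph {n} G = record { V = Fin n ; E = λ u v → T (adj G u v) }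

data Walk (G : Graph) : ℕ → V G → V G → Set where
  here  : ∀ {v} → Walk G zero v v
  step  : ∀ {ℓ u w v} → E G u w → Walk G ℓ w v → Walk G (suc ℓ) u v

Dist≤ : (G : Graph) → ℕ → V G → V G → Set
Dist≤ G r u v = ∃ λ ℓ → ℓ ≤ r × Walk G ℓ u v

-- Burning sequences, 0-indexed: b i (i : Fin k) is the paper's b_{i+1}.
-- Condition 1: b_i is not burned at end of step i-1, i.e. for all j < i,
--   d(b_i, b_j) > (i-1) - j   (1-indexed), which 0-indexed reads the same.
-- Condition 2: every v has some i with d(v, b_i) ≤ k - i (1-indexed),
--   i.e. ≤ k - (i+1) with 0-indexing.
IsBurningSequence : (G : Graph) (k : ℕ) → (Fin k → V G) → Set
IsBurningSequence G k b =
  (∀ (i j : Fin k) → toℕ j < toℕ i →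
      ¬ Dist≤ G (toℕ i ∸ suc (toℕ j)) (b i) (b j))
  × (∀ v → ∃ λ (i : Fin k) → Dist≤ G (k ∸ suc (toℕ i)) v (b i))

HasBurningSequence : Graph → ℕ → Set
HasBurningSequence G k = Σ (Fin k → V G) (IsBurningSequence G k)

IsBurningNumber : Graph → ℕ → Set
IsBurningNumber G β = HasBurningSequence G β × (∀ k → HasBurningSequence G k → β ≤ k)

Connected : Graph → Set
Connected G = ∀ u v → ∃ λ r → Dist≤ G r u v

degree : ∀ {n} → SimpleGraph n → Fin n → ℕ
degree {n} G v = length (filterᵇ (adj G v) (allFin n))

Cubic : ∀ {n} → SimpleGraph n → Set
Cubic G = ∀ v → degree G v ≡ 3

-- H built from m = d-2 copies of G: vertex (i , j) is z_{(i,j)}, the copy of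
-- u_i in G_j.  Edges: copies of G-edges inside each G_j, plus a clique on
-- {z_(i,1), …, z_(i,m)} for every i.
Hcopies : ∀ {n} → SimpleGraph n → ℕ → Graph
Hcopies {n} G m = record
  { V = Fin n × Fin m
  ; E = λ { (i , j) (i' , j') →
            (j ≡ j' × T (adj G i i')) ⊎ (i ≡ i' × j ≢ j') } }

H : ∀ {n} → SimpleGraph n → ℕ → Graph
H G d = Hcopies G (d ∸ 2)

{-# OPTIONS --safe #-}
-- A burning sequence of either graph yields a covering sequence of the other: vertices
-- c₀ … c_{k-1} whose balls of radii k-1-i cover the graph, without the requirement that each
-- source be unburned when placed.  Projecting H onto G keeps the radii, and lifting into one
-- copy of H covers H after one extra round, since every vertex is at distance ≤ 1 from that copy.
-- A covering sequence of length k becomes greedily a burning sequence of length ≤ k: if c_t is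
-- already burned when it is due, the source that burned it also covers the ball of c_t, so c_t
-- may be replaced by any unburned vertex; if there is none, the fire is already complete.
module Submission where

open import Defs
open import Data.Nat using (ℕ; zero; suc; _+_; _∸_; _≤_; _<_; z≤n; s≤s; s≤s⁻¹)
open import Data.Nat.Properties
  using (≤-refl; ≤-trans; ≤-reflexive; <⇒≤; <-≤-trans; n≤1+n; m<n⇒m<1+n; m≤n⇒m<n∨m≡n; <-irrefl;
         +-mono-≤; +-monoˡ-≤; ∸-monoʳ-≤; m∸n+n≡m; +-∸-assoc; +-identityʳ; +-suc; m+n≤o⇒n≤o; _<?_; anyUpTo?)
open import Data.Fin as Fin using (Fin; toℕ; fromℕ<)
open import Data.Fin.Properties using (toℕ<n; toℕ-fromℕ<; fromℕ<-toℕ)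
open import Data.Bool.Properties using (T?)
open import Data.List using (List; allFin; cartesianProduct)
open import Data.List.Relation.Unary.Any using (any?; satisfied)
open import Data.List.Membership.Propositional using (_∈_; lose)
open import Data.List.Membership.Propositional.Properties using (∈-allFin; ∈-cartesianProduct⁺)
open import Data.Product using (_×_; _,_; ∃; proj₁; proj₂)
open import Data.Product.Properties using (≡-dec)
open import Data.Sum using (_⊎_; inj₁; inj₂)
open import Data.Empty using (⊥-elim)
open import Function using (_∘_)
open import Relation.Nullary using (¬_; Dec; yes; no)
open import Relation.Nullary.Decidable using (map′; decidable-stable; _×-dec_; _⊎-dec_; ¬?)
open import Relation.Binary.Definitions using (Decidable; DecidableEquality)
open import Relation.Binary.PropositionalEquality using (_≡_; refl; sym; trans; subst; cong)

m∸n+n∸o≡m∸o : ∀ {m n o} → o ≤ n → n ≤ m → (m ∸ n) + (n ∸ o) ≡ m ∸ o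
m∸n+n∸o≡m∸o z≤n       n≤m       = m∸n+n≡m n≤m
m∸n+n∸o≡m∸o (s≤s o≤n) (s≤s n≤m) = m∸n+n∸o≡m∸o o≤n n≤m

1+m+n≡o⇒n<o : ∀ m {n o} → suc m + n ≡ o → n < o
1+m+n≡o⇒n<o m {n} eq = m+n≤o⇒n≤o m (≤-reflexive (trans (+-suc m n) eq))

extend : {A : Set} → (ℕ → A) → ℕ → A → ℕ → A
extend a t x i with i <? t
... | yes _ = a i
... | no  _ = x

extend-< : ∀ {A : Set} (a : ℕ → A) {t} x {i} → i < t → extend a t x i ≡ a i
extend-< a {t} x {i} i<t with i <? t
... | yes _   = refl
... | no  i≮t = ⊥-elim (i≮t i<t)

extend-self : ∀ {A : Set} (a : ℕ → A) t x → extend a t x t ≡ x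
extend-self a t x with t <? t
... | yes t<t = ⊥-elim (<-irrefl refl t<t)
... | no  _   = refl

module _ (G : Graph) where

  walk-++ : ∀ {ℓ ℓ′ u w v} → Walk G ℓ u w → Walk G ℓ′ w v → Walk G (ℓ + ℓ′) u v
  walk-++ here       q = q
  walk-++ (step e p) q = step e (walk-++ p q)

  Dist≤-mono : ∀ {r s u v} → r ≤ s → Dist≤ G r u v → Dist≤ G s u v
  Dist≤-mono r≤s (ℓ , ℓ≤r , p) = ℓ , ≤-trans ℓ≤r r≤s , p

  Dist≤-trans : ∀ {r s u w v} → Dist≤ G r u w → Dist≤ G s w v → Dist≤ G (r + s) u v
  Dist≤-trans (ℓ , ℓ≤r , p) (ℓ′ , ℓ′≤s , q) = ℓ + ℓ′ , +-mono-≤ ℓ≤r ℓ′≤s , walk-++ p q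

  -- With 0-indexed sources a₀ a₁ …, the source a_j has spread to distance h-1-j after round h.
  record Reached (a : ℕ → V G) (t h : ℕ) (v : V G) : Set where
    constructor reached
    field
      {source} : ℕ
      source<t : source < t
      dist≤    : Dist≤ G (h ∸ suc source) v (a source)

  Burned : (ℕ → V G) → ℕ → V G → Set
  Burned a t = Reached a t t

  Fresh : (ℕ → V G) → ℕ → Set
  Fresh a t = ∀ i → i < t → ¬ Burned a i (a i)

  Covers : (ℕ → V G) → ℕ → Set
  Covers c k = ∀ v → Burned c k v

  Reached-agree : ∀ {a b t h v} → (∀ j → j < t → a j ≡ b j) → Reached a t h v → Reached b t h v
  Reached-agree a≗b (reached {j} j<t d) = reached j<t (subst (Dist≤ G _ _) (a≗b j j<t) d)

  fresh-covers⇒burningSequence : ∀ {a t} → Fresh a t → Covers a t → HasBurningSequence G t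
  fresh-covers⇒burningSequence {a} {t} fresh cover = a ∘ toℕ , unburned , covered
    where
    unburned : ∀ (i j : Fin t) → toℕ j < toℕ i →
               ¬ Dist≤ G (toℕ i ∸ suc (toℕ j)) (a (toℕ i)) (a (toℕ j))
    unburned i j j<i d = fresh (toℕ i) (toℕ<n i) (reached j<i d)

    covered : ∀ v → ∃ λ (i : Fin t) → Dist≤ G (t ∸ suc (toℕ i)) v (a (toℕ i))
    covered v with cover v
    ... | reached {j} j<t d =
      fromℕ< j<t , subst (λ i → Dist≤ G (t ∸ suc i) v (a i)) (sym (toℕ-fromℕ< j<t)) d

  burningSequence⇒covers : ∀ {k} → V G → HasBurningSequence G k → ∃ λ c → Covers c k
  burningSequence⇒covers {k} x (b , _ , covered) = c , cover
    where
    c : ℕ → V G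
    c i with i <? k
    ... | yes i<k = b (fromℕ< i<k)
    ... | no  _   = x

    c-toℕ : ∀ i → c (toℕ i) ≡ b i
    c-toℕ i with toℕ i <? k
    ... | yes i<k = cong b (fromℕ<-toℕ i i<k)
    ... | no  i≮k = ⊥-elim (i≮k (toℕ<n i))

    cover : Covers c k
    cover v with covered v
    ... | i , d = reached (toℕ<n i) (subst (Dist≤ G _ v) (sym (c-toℕ i)) d)

  burningNumber-≤ : ∀ {β k} → IsBurningNumber G β → (∃ λ k′ → k′ ≤ k × HasBurningSequence G k′) → β ≤ k
  burningNumber-≤ (_ , minimal) (k′ , k′≤k , burning) = ≤-trans (minimal k′ burning) k′≤k

module CoveringToBurning (G : Graph) (_≟_ : DecidableEquality (V G)) (E? : Decidable (E G))
                         {vertices : List (V G)} (∈-vertices : ∀ v → v ∈ vertices) where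

  dist? : ∀ r u v → Dec (Dist≤ G r u v)
  dist? zero    u v = map′ (λ { refl → 0 , z≤n , here }) (λ { (0 , _ , here) → refl }) (u ≟ v)
  dist? (suc r) u v =
    map′ (λ { (inj₁ refl) → 0 , z≤n , here
            ; (inj₂ (w , e , ℓ , ℓ≤r , p)) → suc ℓ , s≤s ℓ≤r , step e p })
         (λ { (0 , _ , here) → inj₁ refl
            ; (suc ℓ , s≤s ℓ≤r , step {w = w} e p) → inj₂ (w , e , ℓ , ℓ≤r , p) })
         ((u ≟ v) ⊎-dec map′ satisfied (λ { (w , hit) → lose (∈-vertices w) hit })
                              (any? (λ w → E? u w ×-dec dist? r w v) vertices))

  burned? : ∀ a t v → Dec (Burned G a t v)
  burned? a t v = map′ (λ (_ , j<t , d) → reached j<t d) (λ (reached j<t d) → _ , j<t , d)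
                      (anyUpTo? (λ j → dist? (t ∸ suc j) v (a j)) t)

  allBurned⊎someUnburned : ∀ a t → Covers G a t ⊎ ∃ λ x → ¬ Burned G a t x
  allBurned⊎someUnburned a t with any? (¬? ∘ burned? a t) vertices
  ... | yes some = inj₂ (satisfied some)
  ... | no  none = inj₁ λ v → decidable-stable (burned? a t v) (none ∘ lose (∈-vertices v))

  Fresh-extend : ∀ {a t y} → Fresh G a t → ¬ Burned G a t y → Fresh G (extend a t y) (suc t)
  Fresh-extend {a} {t} {y} fresh y-fresh i i≤t burned with m≤n⇒m<n∨m≡n (s≤s⁻¹ i≤t)
  ... | inj₁ i<t  = fresh i i<t (subst (Burned G a i) (extend-< a y i<t)
                      (Reached-agree G (λ j j<i → extend-< a y (<-≤-trans j<i (<⇒≤ i<t))) burned))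
  ... | inj₂ refl = y-fresh (subst (Burned G a t) (extend-self a t y)
                      (Reached-agree G (λ j j<t → extend-< a y j<t) burned))

  Reached-extend : ∀ {a t h v} y → Reached G a t h v → Reached G (extend a t y) (suc t) h v
  Reached-extend {a} y (reached {j} j<t d) =
    reached (m<n⇒m<1+n j<t) (subst (Dist≤ G _ _) (sym (extend-< a y j<t)) d)

  Burned⇒Reached : ∀ {a t k v y} → t < k → Dist≤ G (k ∸ suc t) v y → Burned G a t y → Reached G a t k v
  Burned⇒Reached {t = t} {k} t<k d (reached {j} j<t d′) =
    reached j<t (Dist≤-mono G radius (Dist≤-trans G d d′))
    where
    radius : (k ∸ suc t) + (t ∸ suc j) ≤ k ∸ suc j
    radius = ≤-trans (+-monoˡ-≤ (t ∸ suc j) (∸-monoʳ-≤ k (n≤1+n t)))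
                     (≤-reflexive (m∸n+n∸o≡m∸o j<t (<⇒≤ t<k)))

  module _ {c : ℕ → V G} {k : ℕ} where

    Dominates : (ℕ → V G) → ℕ → Set
    Dominates a t = ∀ v → Reached G c t k v → Reached G a t k v

    Dominates-extend : ∀ {a t y} → t < k → Dominates a t → y ≡ c t ⊎ Burned G a t (c t) →
                       Dominates (extend a t y) (suc t)
    Dominates-extend {a} {t} {y} t<k dom choice v (reached {j} j≤t d) with m≤n⇒m<n∨m≡n (s≤s⁻¹ j≤t)
    ... | inj₁ j<t = Reached-extend y (dom v (reached j<t d))
    ... | inj₂ refl with choice
    ...   | inj₁ refl   = reached ≤-refl (subst (Dist≤ G _ v) (sym (extend-self a t y)) d)
    ...   | inj₂ burned = Reached-extend y (Burned⇒Reached t<k d burned)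

    nextSource : ∀ a t x → ¬ Burned G a t x → ∃ λ y → ¬ Burned G a t y × (y ≡ c t ⊎ Burned G a t (c t))
    nextSource a t x x-fresh with burned? a t (c t)
    ... | yes burned = x , x-fresh , inj₂ burned
    ... | no  fresh  = c t , fresh , inj₁ refl

    covers⇒burningSequence : Covers G c k → ∃ λ k′ → k′ ≤ k × HasBurningSequence G k′
    covers⇒burningSequence cover = greedy k (+-identityʳ k) (λ _ → c 0) (λ _ ()) (λ { _ (reached () _) })
      where
      greedy : ∀ s {t} → s + t ≡ k → ∀ a → Fresh G a t → Dominates a t →
               ∃ λ k′ → k′ ≤ k × HasBurningSequence G k′
      greedy zero    refl _ fresh dom =
        _ , ≤-refl , fresh-covers⇒burningSequence G fresh (λ v → dom v (cover v))
      greedy (suc s) {t} eq a fresh dom with allBurned⊎someUnburned a t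
      ... | inj₁ covered =
        t , <⇒≤ (1+m+n≡o⇒n<o s eq) , fresh-covers⇒burningSequence G fresh covered
      ... | inj₂ (x , x-fresh) with nextSource a t x x-fresh
      ...   | y , y-fresh , choice =
        greedy s (trans (+-suc s t) eq) (extend a t y)
          (Fresh-extend fresh y-fresh) (Dominates-extend (1+m+n≡o⇒n<o s eq) dom choice)

module _ {n} (G : SimpleGraph n) where

  covers⇒burningSequence-G : ∀ {c k} → Covers (toGraph G) c k →
                             ∃ λ k′ → k′ ≤ k × HasBurningSequence (toGraph G) k′
  covers⇒burningSequence-G =
    CoveringToBurning.covers⇒burningSequence (toGraph G) Fin._≟_ (λ u v → T? (adj G u v)) ∈-allFin

  module _ (m : ℕ) where

    Hcopies-adj? : Decidable (E (Hcopies G m))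
    Hcopies-adj? (i , j) (i′ , j′) =
      ((j Fin.≟ j′) ×-dec T? (adj G i i′)) ⊎-dec ((i Fin.≟ i′) ×-dec ¬? (j Fin.≟ j′))

    covers⇒burningSequence-H : ∀ {c k} → Covers (Hcopies G m) c k →
                               ∃ λ k′ → k′ ≤ k × HasBurningSequence (Hcopies G m) k′
    covers⇒burningSequence-H =
      CoveringToBurning.covers⇒burningSequence (Hcopies G m) (≡-dec Fin._≟_ Fin._≟_) Hcopies-adj?
        {cartesianProduct (allFin n) (allFin m)} (λ (i , j) → ∈-cartesianProduct⁺ (∈-allFin i) (∈-allFin j))

    project-walk : ∀ {ℓ x y} → Walk (Hcopies G m) ℓ x y → Dist≤ (toGraph G) ℓ (proj₁ x) (proj₁ y)
    project-walk here                       = 0 , z≤n , here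
    project-walk (step (inj₁ (refl , e)) p) with project-walk p
    ... | ℓ , ℓ≤ , q = suc ℓ , s≤s ℓ≤ , step e q
    project-walk (step (inj₂ (refl , _)) p)  = Dist≤-mono (toGraph G) (n≤1+n _) (project-walk p)

    project-Dist≤ : ∀ {r x y} → Dist≤ (Hcopies G m) r x y → Dist≤ (toGraph G) r (proj₁ x) (proj₁ y)
    project-Dist≤ (ℓ , ℓ≤r , p) = Dist≤-mono (toGraph G) ℓ≤r (project-walk p)

    lift-walk : ∀ {ℓ u v} j → Walk (toGraph G) ℓ u v → Walk (Hcopies G m) ℓ (u , j) (v , j)
    lift-walk j here       = here
    lift-walk j (step e p) = step (inj₁ (refl , e)) (lift-walk j p)

    lift-Dist≤ : ∀ {r u v} j → Dist≤ (toGraph G) r u v → Dist≤ (Hcopies G m) r (u , j) (v , j)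
    lift-Dist≤ j (ℓ , ℓ≤r , p) = ℓ , ℓ≤r , lift-walk j p

    Dist≤-copies : ∀ v j j′ → Dist≤ (Hcopies G m) 1 (v , j) (v , j′)
    Dist≤-copies v j j′ with j Fin.≟ j′
    ... | yes refl = 0 , z≤n , here
    ... | no  j≢j′ = 1 , ≤-refl , step (inj₂ (refl , j≢j′)) here

    project-Covers : ∀ {c k} → Fin m → Covers (Hcopies G m) c k → Covers (toGraph G) (proj₁ ∘ c) k
    project-Covers j cover v with cover (v , j)
    ... | reached i<k d = reached i<k (project-Dist≤ d)

    lift-Covers : ∀ {c k} j → Covers (toGraph G) c k → Covers (Hcopies G m) (λ i → c i , j) (suc k)
    lift-Covers j cover (v , j′) with cover v
    ... | reached {i} i<k d = reached (m<n⇒m<1+n i<k)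
      (Dist≤-mono (Hcopies G m) (≤-reflexive (sym (+-∸-assoc 1 i<k)))
        (Dist≤-trans (Hcopies G m) (Dist≤-copies v j′ j) (lift-Dist≤ j d)))

empty-burningSequence : ∀ (Γ : Graph) → ¬ V Γ → HasBurningSequence Γ 0
empty-burningSequence Γ empty = (λ ()) , (λ ()) , λ v → ⊥-elim (empty v)

lemma27 : ∀ {n} (G : SimpleGraph n) → Connected (toGraph G) → Cubic G →
    ∀ (d : ℕ) → 3 ≤ d → ∀ (βG βH : ℕ) →
    IsBurningNumber (toGraph G) βG → IsBurningNumber (H G d) βH →
    βG ≤ βH × βH ≤ suc βG
lemma27 {zero} G _ _ d _ βG βH isG isH =
  burningNumber-≤ (toGraph G) isG (0 , z≤n , empty-burningSequence (toGraph G) λ ()) ,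
  burningNumber-≤ (H G d) isH (0 , z≤n , empty-burningSequence (H G d) λ { (() , _) })
lemma27 {suc n} G _ _ (suc (suc (suc m))) (s≤s (s≤s (s≤s _))) βG βH isG isH =
  burningNumber-≤ (toGraph G) isG
    (covers⇒burningSequence-G G (project-Covers G (suc m) Fin.zero (proj₂ coveringH))) ,
  burningNumber-≤ (H G (3 + m)) isH
    (covers⇒burningSequence-H G (suc m) (lift-Covers G (suc m) Fin.zero (proj₂ coveringG)))
  where
  coveringG : ∃ λ c → Covers (toGraph G) c βG
  coveringG = burningSequence⇒covers (toGraph G) Fin.zero (proj₁ isG)

  coveringH : ∃ λ c → Covers (H G (3 + m)) c βH
  coveringH = burningSequence⇒covers (H G (3 + m)) (Fin.zero , Fin.zero) (proj₁ isH)
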